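{- Let $D$ be a demicap in $AG(4,3)$ with anchor point $a$. Then the 71 points of $AG(4,3)$ not in $D$ consist of the anchor point $a$, exactly 40 points each completing exactly one line with a pair of points of $D$, and exactly 30 points completing no line with a pair of points of $D$.
   Context: $AG(4,3)=\mathbb{F}_3^4$ with lines the triples of distinct points $x,y,z$ with $x+y+z=0$. A cap is a set of points containing no line. A hyperplane is a 3-dimensional affine subspace. For a point $a$, an $a$-line is a pair $\{b,c\}$ with $\{a,b,c\}$ a line. A demicap with anchor point $a$ is a cap consisting of five $a$-lines such that no four of the corresponding lines through $a$ lie in a common hyperplane. A point $p\notin D$ completes a line with a pair of points of $D$ if $\{p,x,y\}$ is a line for some $x,y\in D$. -}

module Defs where

open import Data.Nat using (ℕ; zero; suc)
open import Data.Fin using (Fin; zero; suc)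
open import Data.Fin.Properties using () renaming (_≟_ to _≟ᶠ_)
open import Data.Vec using (Vec; []; _∷_; zipWith; replicate; foldr)
open import Data.Vec.Properties using (≡-dec)
open import Data.List using (List; []; _∷_; [_]; map; concatMap; _++_; length; filter; allFin)
open import Data.Product using (_×_; _,_; ∃; Σ)
open import Data.Sum using (_⊎_)
open import Relation.Nullary using (¬_; Dec; yes; no)
open import Relation.Nullary.Decidable using (_×-dec_; ¬?)
open import Relation.Binary.PropositionalEquality using (_≡_; _≢_)
open import Function.Definitions using (Injective)
import Data.List.Membership.DecPropositional as DecMem

F₃ : Set
F₃ = Fin 3

_⊕_ : F₃ → F₃ → F₃
zero ⊕ y = y
suc zero ⊕ zero = suc zero
suc zero ⊕ suc zero = suc (suc zero)
suc zero ⊕ suc (suc zero) = zero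
suc (suc zero) ⊕ zero = suc (suc zero)
suc (suc zero) ⊕ suc zero = zero
suc (suc zero) ⊕ suc (suc zero) = suc zero

_⊗_ : F₃ → F₃ → F₃
zero ⊗ y = zero
suc zero ⊗ y = y
suc (suc zero) ⊗ zero = zero
suc (suc zero) ⊗ suc zero = suc (suc zero)
suc (suc zero) ⊗ suc (suc zero) = suc zero

Point : Set
Point = Vec F₃ 4

_≟ₚ_ : (x y : Point) → Dec (x ≡ y)
_≟ₚ_ = ≡-dec _≟ᶠ_

_+ₚ_ : Point → Point → Point
_+ₚ_ = zipWith _⊕_

𝟎 : Point
𝟎 = replicate 4 zero

allVecs : (n : ℕ) → List (Vec F₃ n)
allVecs zero = [ [] ]
allVecs (suc n) = concatMap (λ x → map (x ∷_) (allVecs n)) (allFin 3)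

allPoints : List Point
allPoints = allVecs 4

IsLine : Point → Point → Point → Set
IsLine x y z = x ≢ y × y ≢ z × x ≢ z × (x +ₚ y) +ₚ z ≡ 𝟎

isLine? : (x y z : Point) → Dec (IsLine x y z)
isLine? x y z =
  ¬? (x ≟ₚ y) ×-dec (¬? (y ≟ₚ z) ×-dec (¬? (x ≟ₚ z) ×-dec (((x +ₚ y) +ₚ z) ≟ₚ 𝟎)))

-- Hyperplanes (3-dimensional affine subspaces of F₃⁴): solution sets
-- { x | f · x = t } of one nontrivial affine linear equation.
dot : Point → Point → F₃
dot f x = foldr _ _⊕_ zero (zipWith _⊗_ f x)

record Hyperplane : Set where
  field
    normal   : Point
    nonzero  : normal ≢ 𝟎
    constant : F₃

_∈H_ : Point → Hyperplane → Set
x ∈H H = dot (Hyperplane.normal H) x ≡ Hyperplane.constant H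

open DecMem _≟ₚ_ public using (_∈_; _∉_; _∈?_)

pairsOf : {A : Set} → List A → List (A × A)
pairsOf [] = []
pairsOf (x ∷ xs) = map (x ,_) xs ++ pairsOf xs

record Demicap : Set where
  field
    anchor : Point
    b c    : Fin 5 → Point
    aLine  : ∀ i → IsLine anchor (b i) (c i)
    distinctLines : ∀ i j → i ≢ j →
      ¬ ((b i ≡ b j × c i ≡ c j) ⊎ (b i ≡ c j × c i ≡ b j))

  points : List Point
  points = concatMap (λ i → b i ∷ c i ∷ []) (allFin 5)

  field
    isCap : ∀ x y z → x ∈ points → y ∈ points → z ∈ points → ¬ IsLine x y z
    noFourInHyperplane : (σ : Fin 4 → Fin 5) → Injective _≡_ _≡_ σ →
      ¬ (Σ Hyperplane λ H → ∀ k →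
           anchor ∈H H × b (σ k) ∈H H × c (σ k) ∈H H)

  completions : Point → ℕ
  completions p = length (filter (λ xy → isLine? p (Data.Product.proj₁ xy) (Data.Product.proj₂ xy)) (pairsOf points))

-- Write the points of D as b i = a + u i and c i = a − u i.  The third point −(x + y) of
-- the line through a pair {x, y} of D is a for the five pairs {b i, c i}, and lies off D ∪ {a}
-- for the other 40 pairs, since D is a cap and the lines through a meet D only in the pairs
-- {b i, c i}.  If two different such pairs had the same third point, the points' coordinates
-- would give a nontrivial ±1-relation among at most four of the u i, putting four of the
-- lines through a into one hyperplane.  So the 40 third points are distinct, each point
-- other than a completes at most one line, and the 71 points off D split as 1 + 40 + 30.
module Submission where

open import Algebra.Properties.CommutativeSemigroup using (interchange)
open import Data.Bool using (Bool; true; false; not)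
open import Data.Bool.Properties using () renaming (_≟_ to _≟ᵇ_)
open import Data.Empty using (⊥-elim)
open import Data.Fin using (Fin; zero; suc; punchIn; punchOut)
open import Data.Fin.Properties using (all?; any?; punchIn-punchOut; punchIn-injective; suc-injective)
  renaming (_≟_ to _≟ᶠ_)
import Data.List as List
open import Data.List using (List; []; _∷_; length; filter)
open import Data.List.Membership.Propositional.Properties using (∈-map⁺; ∈-map⁻)
import Data.List.Membership.DecPropositional as DecMembership
open import Data.List.Relation.Unary.All as All using (All; []; _∷_)
open import Data.List.Relation.Unary.All.Properties using (All¬⇒¬Any)
open import Data.List.Relation.Unary.AllPairs as AllPairs using (AllPairs; []; _∷_; allPairs?)
open import Data.List.Relation.Unary.Any using (here; there)
open import Data.List.Relation.Unary.Unique.Propositional using (Unique)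
import Data.List.Relation.Unary.Unique.Propositional.Properties as Unique
open import Data.Nat using (ℕ; zero; suc; _+_; _*_; _≤_; z≤n; s≤s; _≟_)
open import Data.Nat.ListAction using (sum)
open import Data.Nat.Properties
  using (≤-refl; ≤-reflexive; +-assoc; +-cancelʳ-≡; *-zeroʳ; *-identityʳ; *-distribˡ-+; +-commutativeSemigroup)
open import Data.Product using (_×_; _,_; proj₁; proj₂; Σ-syntax; ∃-syntax)
open import Data.Product.Properties using () renaming (≡-dec to ≡-dec-×)
open import Data.Sum using (_⊎_; inj₁; inj₂)
open import Data.Vec using (Vec; []; _∷_; zipWith; replicate; map; foldr; head; tail)
open import Data.Vec.Properties using (∷-injective)
open import Defs
open import Function using (_∘_)
open import Relation.Binary.PropositionalEquality
  using (_≡_; _≢_; refl; sym; trans; cong; cong₂; subst; module ≡-Reasoning)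
open import Relation.Nullary using (¬_; Dec; yes; no; _because_)
open import Relation.Nullary.Decidable using (from-yes; _→-dec_; ¬?; _×-dec_; _⊎-dec_; decidable-stable)
open import Relation.Unary using (Decidable)

-- Vectors over F₃

F0 F1 F2 : F₃
F0 = zero
F1 = suc zero
F2 = suc (suc zero)

infixl 6 _⊞_
infixr 7 _⊙_
infix 8 _·_

_⊞_ : ∀ {n} → Vec F₃ n → Vec F₃ n → Vec F₃ n
_⊞_ = zipWith _⊕_

_⊙_ : ∀ {n} → F₃ → Vec F₃ n → Vec F₃ n
k ⊙ v = map (k ⊗_) v

zeros : ∀ {n} → Vec F₃ n
zeros {n} = replicate n F0

-- At n = 4 this is definitionally Defs.dot, so hyperplane membership can be stated with it.
_·_ : ∀ {n} → Vec F₃ n → Vec F₃ n → F₃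
f · x = foldr (λ _ → F₃) _⊕_ F0 (zipWith _⊗_ f x)

private
  ∷-injectiveˡ : ∀ {n x y} {xs ys : Vec F₃ n} → x ∷ xs ≡ y ∷ ys → x ≡ y
  ∷-injectiveˡ = proj₁ ∘ ∷-injective

  ∷-injectiveʳ : ∀ {n x y} {xs ys : Vec F₃ n} → x ∷ xs ≡ y ∷ ys → xs ≡ ys
  ∷-injectiveʳ = proj₂ ∘ ∷-injective

⊕-identityʳ : ∀ x → x ⊕ F0 ≡ x
⊕-identityʳ = from-yes (all? λ x → (x ⊕ F0) ≟ᶠ x)

⊗-zeroʳ : ∀ x → x ⊗ F0 ≡ F0
⊗-zeroʳ = from-yes (all? λ x → (x ⊗ F0) ≟ᶠ F0)

⊗-cancel : ∀ k x → k ≢ F0 → k ⊗ x ≡ F0 → x ≡ F0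
⊗-cancel = from-yes (all? λ k → all? λ x → ¬? (k ≟ᶠ F0) →-dec ((k ⊗ x) ≟ᶠ F0 →-dec (x ≟ᶠ F0)))

⊙-zero : ∀ {n} k → k ⊙ zeros {n} ≡ zeros
⊙-zero {zero} k = refl
⊙-zero {suc n} k = cong₂ _∷_ (⊗-zeroʳ k) (⊙-zero k)

⊞-identityʳ : ∀ {n} (v : Vec F₃ n) → v ⊞ zeros ≡ v
⊞-identityʳ [] = refl
⊞-identityʳ (x ∷ v) = cong₂ _∷_ (⊕-identityʳ x) (⊞-identityʳ v)

zero-⊙-⊞ : ∀ {n} (v w : Vec F₃ n) → F0 ⊙ v ⊞ w ≡ w
zero-⊙-⊞ [] [] = refl
zero-⊙-⊞ (x ∷ v) (y ∷ w) = cong (y ∷_) (zero-⊙-⊞ v w)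

·-zerosˡ : ∀ {n} (v : Vec F₃ n) → zeros · v ≡ F0
·-zerosˡ [] = refl
·-zerosˡ (x ∷ v) = ·-zerosˡ v

·-zerosʳ : ∀ {n} (f : Vec F₃ n) → f · zeros ≡ F0
·-zerosʳ [] = refl
·-zerosʳ (x ∷ f) = trans (cong ((x ⊗ F0) ⊕_) (·-zerosʳ f)) (from-yes (all? λ x → ((x ⊗ F0) ⊕ F0) ≟ᶠ F0) x)

·-⊞ : ∀ {n} (f x y : Vec F₃ n) → f · (x ⊞ y) ≡ (f · x) ⊕ (f · y)
·-⊞ [] [] [] = refl
·-⊞ (f ∷ fs) (x ∷ xs) (y ∷ ys) =
  trans (cong ((f ⊗ (x ⊕ y)) ⊕_) (·-⊞ fs xs ys)) (step f x y (fs · xs) (fs · ys))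
  where
  step : ∀ f x y s t → (f ⊗ (x ⊕ y)) ⊕ (s ⊕ t) ≡ ((f ⊗ x) ⊕ s) ⊕ ((f ⊗ y) ⊕ t)
  step = from-yes (all? λ f → all? λ x → all? λ y → all? λ s → all? λ t →
    ((f ⊗ (x ⊕ y)) ⊕ (s ⊕ t)) ≟ᶠ (((f ⊗ x) ⊕ s) ⊕ ((f ⊗ y) ⊕ t)))

·-⊙ : ∀ {n} (f : Vec F₃ n) k x → f · (k ⊙ x) ≡ k ⊗ (f · x)
·-⊙ [] k [] = sym (⊗-zeroʳ k)
·-⊙ (f ∷ fs) k (x ∷ xs) = trans (cong ((f ⊗ (k ⊗ x)) ⊕_) (·-⊙ fs k xs)) (step f k x (fs · xs))
  where
  step : ∀ f k x s → (f ⊗ (k ⊗ x)) ⊕ (k ⊗ s) ≡ k ⊗ ((f ⊗ x) ⊕ s)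
  step = from-yes (all? λ f → all? λ k → all? λ x → all? λ s →
    ((f ⊗ (k ⊗ x)) ⊕ (k ⊗ s)) ≟ᶠ (k ⊗ ((f ⊗ x) ⊕ s)))

·-⊞-⊙-annihilated : ∀ {n} (f x v : Vec F₃ n) k → f · v ≡ F0 → f · (x ⊞ k ⊙ v) ≡ f · x
·-⊞-⊙-annihilated f x v k f⊥v = begin
  f · (x ⊞ k ⊙ v)         ≡⟨ ·-⊞ f x (k ⊙ v) ⟩
  (f · x) ⊕ (f · (k ⊙ v)) ≡⟨ cong ((f · x) ⊕_) (·-⊙ f k v) ⟩
  (f · x) ⊕ (k ⊗ (f · v)) ≡⟨ cong (λ y → (f · x) ⊕ (k ⊗ y)) f⊥v ⟩
  (f · x) ⊕ (k ⊗ F0)      ≡⟨ cong ((f · x) ⊕_) (⊗-zeroʳ k) ⟩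
  (f · x) ⊕ F0            ≡⟨ ⊕-identityʳ (f · x) ⟩
  f · x                   ∎
  where open ≡-Reasoning

-- Linear combinations and annihilators

lin : ∀ {m n} → (Fin m → F₃) → (Fin m → Vec F₃ n) → Vec F₃ n
lin {zero} c vs = zeros
lin {suc m} c vs = c zero ⊙ vs zero ⊞ lin (c ∘ suc) (vs ∘ suc)

lin-⊞ : ∀ {m n} (c d : Fin m → F₃) (vs : Fin m → Vec F₃ n) →
        lin (λ k → c k ⊕ d k) vs ≡ lin c vs ⊞ lin d vs
lin-⊞ {zero} c d vs = sym (⊞-identityʳ zeros)
lin-⊞ {suc m} c d vs =
  trans (cong ((c zero ⊕ d zero) ⊙ vs zero ⊞_) (lin-⊞ (c ∘ suc) (d ∘ suc) (vs ∘ suc)))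
        (⊙-⊞-interchange (c zero) (d zero) (vs zero) _ _)
  where
  ⊙-⊞-interchange : ∀ {n} k l (v x y : Vec F₃ n) → (k ⊕ l) ⊙ v ⊞ (x ⊞ y) ≡ (k ⊙ v ⊞ x) ⊞ (l ⊙ v ⊞ y)
  ⊙-⊞-interchange k l [] [] [] = refl
  ⊙-⊞-interchange k l (v ∷ vs) (x ∷ xs) (y ∷ ys) = cong₂ _∷_ (step k l v x y) (⊙-⊞-interchange k l vs xs ys)
    where
    step : ∀ k l v x y → ((k ⊕ l) ⊗ v) ⊕ (x ⊕ y) ≡ ((k ⊗ v) ⊕ x) ⊕ ((l ⊗ v) ⊕ y)
    step = from-yes (all? λ k → all? λ l → all? λ v → all? λ x → all? λ y →
      (((k ⊕ l) ⊗ v) ⊕ (x ⊕ y)) ≟ᶠ (((k ⊗ v) ⊕ x) ⊕ ((l ⊗ v) ⊕ y)))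

lin-⊙ : ∀ {m n} s (c : Fin m → F₃) (vs : Fin m → Vec F₃ n) → lin (λ k → s ⊗ c k) vs ≡ s ⊙ lin c vs
lin-⊙ {zero} s c vs = sym (⊙-zero s)
lin-⊙ {suc m} s c vs =
  trans (cong ((s ⊗ c zero) ⊙ vs zero ⊞_) (lin-⊙ s (c ∘ suc) (vs ∘ suc))) (distrib s (c zero) (vs zero) _)
  where
  distrib : ∀ {n} s k (v x : Vec F₃ n) → (s ⊗ k) ⊙ v ⊞ s ⊙ x ≡ s ⊙ (k ⊙ v ⊞ x)
  distrib s k [] [] = refl
  distrib s k (v ∷ vs) (x ∷ xs) = cong₂ _∷_ (step s k v x) (distrib s k vs xs)
    where
    step : ∀ s k v x → ((s ⊗ k) ⊗ v) ⊕ (s ⊗ x) ≡ s ⊗ ((k ⊗ v) ⊕ x)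
    step = from-yes (all? λ s → all? λ k → all? λ v → all? λ x →
      (((s ⊗ k) ⊗ v) ⊕ (s ⊗ x)) ≟ᶠ (s ⊗ ((k ⊗ v) ⊕ x)))

lin-zero : ∀ {m n} (vs : Fin m → Vec F₃ n) → lin (λ _ → F0) vs ≡ zeros
lin-zero {zero} vs = refl
lin-zero {suc m} vs = trans (zero-⊙-⊞ (vs zero) _) (lin-zero (vs ∘ suc))

unit : ∀ {m} → Fin m → F₃ → Fin m → F₃
unit zero    s zero    = s
unit zero    s (suc k) = F0
unit (suc i) s zero    = F0
unit (suc i) s (suc k) = unit i s k

lin-unit : ∀ {m n} i s (vs : Fin m → Vec F₃ n) → lin (unit i s) vs ≡ s ⊙ vs i
lin-unit zero s vs = trans (cong (s ⊙ vs zero ⊞_) (lin-zero (vs ∘ suc))) (⊞-identityʳ _)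
lin-unit {suc m} (suc i) s vs = trans (zero-⊙-⊞ (vs zero) _) (lin-unit i s (vs ∘ suc))

lin-punchIn : ∀ {m n} (c : Fin (suc m) → F₃) (vs : Fin (suc m) → Vec F₃ n) j →
              c j ≡ F0 → lin c vs ≡ lin (c ∘ punchIn j) (vs ∘ punchIn j)
lin-punchIn c vs zero c0≡0 =
  trans (cong (λ k → k ⊙ vs zero ⊞ lin (c ∘ suc) (vs ∘ suc)) c0≡0) (zero-⊙-⊞ (vs zero) _)
lin-punchIn {suc m} c vs (suc j) cj≡0 =
  cong (c zero ⊙ vs zero ⊞_) (lin-punchIn (c ∘ suc) (vs ∘ suc) j cj≡0)

·-lin-annihilated : ∀ {m n} (f : Vec F₃ n) c (vs : Fin m → Vec F₃ n) →
                    (∀ k → f · vs k ≡ F0) → f · lin c vs ≡ F0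
·-lin-annihilated {zero} f c vs ann = ·-zerosʳ f
·-lin-annihilated {suc m} f c vs ann = begin
  f · (c zero ⊙ vs zero ⊞ lin (c ∘ suc) (vs ∘ suc))        ≡⟨ ·-⊞ f _ _ ⟩
  (f · (c zero ⊙ vs zero)) ⊕ (f · lin (c ∘ suc) (vs ∘ suc)) ≡⟨ cong₂ _⊕_ (·-⊙ f _ _) (·-lin-annihilated f _ _ (ann ∘ suc)) ⟩
  (c zero ⊗ (f · vs zero)) ⊕ F0                            ≡⟨ ⊕-identityʳ _ ⟩
  c zero ⊗ (f · vs zero)                                   ≡⟨ cong (c zero ⊗_) (ann zero) ⟩
  c zero ⊗ F0                                              ≡⟨ ⊗-zeroʳ (c zero) ⟩
  F0                                                       ∎
  where open ≡-Reasoning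

·-lin-except : ∀ {m n} (f : Vec F₃ n) c (vs : Fin m → Vec F₃ n) j →
               (∀ k → k ≢ j → f · vs k ≡ F0) → f · lin c vs ≡ c j ⊗ (f · vs j)
·-lin-except f c vs zero ann = begin
  f · (c zero ⊙ vs zero ⊞ lin (c ∘ suc) (vs ∘ suc))        ≡⟨ ·-⊞ f _ _ ⟩
  (f · (c zero ⊙ vs zero)) ⊕ (f · lin (c ∘ suc) (vs ∘ suc)) ≡⟨ cong₂ _⊕_ (·-⊙ f _ _) (·-lin-annihilated f _ _ λ k → ann (suc k) λ ()) ⟩
  (c zero ⊗ (f · vs zero)) ⊕ F0                            ≡⟨ ⊕-identityʳ _ ⟩
  c zero ⊗ (f · vs zero)                                   ∎
  where open ≡-Reasoning
·-lin-except {suc m} f c vs (suc j) ann = begin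
  f · (c zero ⊙ vs zero ⊞ lin (c ∘ suc) (vs ∘ suc))        ≡⟨ ·-⊞ f _ _ ⟩
  (f · (c zero ⊙ vs zero)) ⊕ (f · lin (c ∘ suc) (vs ∘ suc)) ≡⟨ cong₂ _⊕_ (·-⊙ f _ _) (·-lin-except f _ _ j λ k k≢j → ann (suc k) (k≢j ∘ suc-injective)) ⟩
  (c zero ⊗ (f · vs zero)) ⊕ (c (suc j) ⊗ (f · vs (suc j))) ≡⟨ cong (λ x → (c zero ⊗ x) ⊕ (c (suc j) ⊗ (f · vs (suc j)))) (ann zero λ ()) ⟩
  (c zero ⊗ F0) ⊕ (c (suc j) ⊗ (f · vs (suc j)))           ≡⟨ from-yes (all? λ k → all? λ x → ((k ⊗ F0) ⊕ x) ≟ᶠ x) (c zero) _ ⟩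
  c (suc j) ⊗ (f · vs (suc j))                             ∎
  where open ≡-Reasoning

punchIn-cover : ∀ {m} (P : Fin (suc m) → Set) j → (∀ k → P (punchIn j k)) → ∀ k → k ≢ j → P k
punchIn-cover P j h k k≢j = subst P (punchIn-punchOut (k≢j ∘ sym)) (h _)

NonzeroAnnihilator : ∀ {m n} → (Fin m → Vec F₃ n) → Set
NonzeroAnnihilator {n = n} vs = Σ[ f ∈ Vec F₃ n ] f ≢ zeros × (∀ k → f · vs k ≡ F0)

·-cons : ∀ {n} x (g : Vec F₃ n) w → (x ∷ g) · w ≡ (x ⊗ head w) ⊕ (g · tail w)
·-cons x g (y ∷ w) = refl

head-⊞-⊙ : ∀ {n} (w : Vec F₃ (suc n)) k q → head (w ⊞ k ⊙ q) ≡ head w ⊕ (k ⊗ head q)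
head-⊞-⊙ (x ∷ w) k (y ∷ q) = refl

-- Gaussian elimination on the first coordinate against a pivot p; the coefficients below
-- use that the nonzero head p is its own inverse in F₃.
module Elimination {n} (p : Vec F₃ (suc n)) (pivot : head p ≢ F0) where

  eliminate : Vec F₃ (suc n) → Vec F₃ (suc n)
  eliminate w = w ⊞ (F2 ⊗ (head w ⊗ head p)) ⊙ p

  head-eliminate : ∀ w → head (eliminate w) ≡ F0
  head-eliminate w = trans (head-⊞-⊙ w _ p) (step (head p) (head w) pivot)
    where
    step : ∀ h x → h ≢ F0 → x ⊕ ((F2 ⊗ (x ⊗ h)) ⊗ h) ≡ F0
    step = from-yes (all? λ h → all? λ x → ¬? (h ≟ᶠ F0) →-dec ((x ⊕ ((F2 ⊗ (x ⊗ h)) ⊗ h)) ≟ᶠ F0))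

  extend : Vec F₃ n → Vec F₃ (suc n)
  extend g = (F2 ⊗ (head p ⊗ (g · tail p))) ∷ g

  extend-annihilates-pivot : ∀ g → extend g · p ≡ F0
  extend-annihilates-pivot g = trans (·-cons _ g p) (step (head p) (g · tail p) pivot)
    where
    step : ∀ h s → h ≢ F0 → ((F2 ⊗ (h ⊗ s)) ⊗ h) ⊕ s ≡ F0
    step = from-yes (all? λ h → all? λ s → ¬? (h ≟ᶠ F0) →-dec ((((F2 ⊗ (h ⊗ s)) ⊗ h) ⊕ s) ≟ᶠ F0))

  extend-annihilates : ∀ g w → g · tail (eliminate w) ≡ F0 → extend g · w ≡ F0
  extend-annihilates g w g⊥w′ = begin
    f · w                                                    ≡⟨ sym (·-⊞-⊙-annihilated f w p _ (extend-annihilates-pivot g)) ⟩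
    f · eliminate w                                          ≡⟨ ·-cons _ g (eliminate w) ⟩
    (head f ⊗ head (eliminate w)) ⊕ (g · tail (eliminate w)) ≡⟨ cong₂ (λ x y → (head f ⊗ x) ⊕ y) (head-eliminate w) g⊥w′ ⟩
    (head f ⊗ F0) ⊕ F0                                       ≡⟨ trans (⊕-identityʳ _) (⊗-zeroʳ (head f)) ⟩
    F0                                                       ∎
    where
    open ≡-Reasoning
    f = extend g

annihilator-of-few : ∀ {m n} → m ≤ n → (vs : Fin m → Vec F₃ (suc n)) → NonzeroAnnihilator vs
annihilator-of-few {zero} _ vs = F1 ∷ zeros , (λ ()) , λ ()
annihilator-of-few {suc m} (s≤s m≤n) vs with any? (λ k → ¬? (head (vs k) ≟ᶠ F0))
... | no noPivot = F1 ∷ zeros , (λ ()) , e₀-annihilates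
  where
  e₀-annihilates : ∀ k → (F1 ∷ zeros) · vs k ≡ F0
  e₀-annihilates k = begin
    (F1 ∷ zeros) · vs k                   ≡⟨ ·-cons F1 zeros (vs k) ⟩
    head (vs k) ⊕ (zeros · tail (vs k))   ≡⟨ cong (head (vs k) ⊕_) (·-zerosˡ (tail (vs k))) ⟩
    head (vs k) ⊕ F0                      ≡⟨ ⊕-identityʳ _ ⟩
    head (vs k)                           ≡⟨ decidable-stable (head (vs k) ≟ᶠ F0) (λ ne → noPivot (k , ne)) ⟩
    F0                                    ∎
    where open ≡-Reasoning
... | yes (j , pivot) = extend g , extend≢zeros , annihilates
  where
  open Elimination (vs j) pivot
  reduced = annihilator-of-few m≤n (λ k → tail (eliminate (vs (punchIn j k))))
  g = proj₁ reduced

  extend≢zeros : extend g ≢ zeros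
  extend≢zeros = proj₁ (proj₂ reduced) ∘ ∷-injectiveʳ

  annihilates : ∀ k → extend g · vs k ≡ F0
  annihilates k with k ≟ᶠ j
  ... | yes refl = extend-annihilates-pivot g
  ... | no k≢j = punchIn-cover (λ i → extend g · vs i ≡ F0) j
                   (λ i → extend-annihilates g (vs (punchIn j i)) (proj₂ (proj₂ reduced) i)) k k≢j

annihilator-of-dependent : ∀ {m n} → m ≤ n →
  (vs : Fin (suc m) → Vec F₃ (suc n)) (c : Fin (suc m) → F₃) (j : Fin (suc m)) →
  c j ≢ F0 → lin c vs ≡ zeros → NonzeroAnnihilator vs
annihilator-of-dependent m≤n vs c j cj≢0 relation = f , f≢0 , annihilates
  where
  others = annihilator-of-few m≤n (vs ∘ punchIn j)
  f = proj₁ others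
  f≢0 = proj₁ (proj₂ others)
  annihilates-others : ∀ k → k ≢ j → f · vs k ≡ F0
  annihilates-others = punchIn-cover (λ i → f · vs i ≡ F0) j (proj₂ (proj₂ others))

  annihilates : ∀ k → f · vs k ≡ F0
  annihilates k with k ≟ᶠ j
  ... | no k≢j = annihilates-others k k≢j
  ... | yes refl = ⊗-cancel (c k) (f · vs k) cj≢0 (begin
    c k ⊗ (f · vs k)   ≡⟨ sym (·-lin-except f c vs k annihilates-others) ⟩
    f · lin c vs       ≡⟨ cong (f ·_) relation ⟩
    f · zeros          ≡⟨ ·-zerosʳ f ⟩
    F0                 ∎)
    where open ≡-Reasoning

-- Lines of AG(n, 3)

-- In characteristic 3 the third point of the line through x and y is −(x + y).
third : ∀ {n} → Vec F₃ n → Vec F₃ n → Vec F₃ n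
third x y = F2 ⊙ (x ⊞ y)

third-comm : ∀ {n} (x y : Vec F₃ n) → third x y ≡ third y x
third-comm [] [] = refl
third-comm (x ∷ xs) (y ∷ ys) = cong₂ _∷_ (step x y) (third-comm xs ys)
  where
  step : ∀ x y → F2 ⊗ (x ⊕ y) ≡ F2 ⊗ (y ⊕ x)
  step = from-yes (all? λ x → all? λ y → (F2 ⊗ (x ⊕ y)) ≟ᶠ (F2 ⊗ (y ⊕ x)))

third-involutive : ∀ {n} (x y : Vec F₃ n) → third x (third x y) ≡ y
third-involutive [] [] = refl
third-involutive (x ∷ xs) (y ∷ ys) = cong₂ _∷_ (step x y) (third-involutive xs ys)
  where
  step : ∀ x y → F2 ⊗ (x ⊕ (F2 ⊗ (x ⊕ y))) ≡ y
  step = from-yes (all? λ x → all? λ y → (F2 ⊗ (x ⊕ (F2 ⊗ (x ⊕ y)))) ≟ᶠ y)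

third≡ˡ⇒≡ : ∀ {n} (x y : Vec F₃ n) → third x y ≡ x → x ≡ y
third≡ˡ⇒≡ [] [] _ = refl
third≡ˡ⇒≡ (x ∷ xs) (y ∷ ys) eq = cong₂ _∷_ (step x y (∷-injectiveˡ eq)) (third≡ˡ⇒≡ xs ys (∷-injectiveʳ eq))
  where
  step : ∀ x y → F2 ⊗ (x ⊕ y) ≡ x → x ≡ y
  step = from-yes (all? λ x → all? λ y → ((F2 ⊗ (x ⊕ y)) ≟ᶠ x) →-dec (x ≟ᶠ y))

third≡ʳ⇒≡ : ∀ {n} (x y : Vec F₃ n) → third x y ≡ y → x ≡ y
third≡ʳ⇒≡ x y eq = sym (third≡ˡ⇒≡ y x (trans (third-comm y x) eq))

sum≡zeros⇒≡third : ∀ {n} (p x y : Vec F₃ n) → (p ⊞ x) ⊞ y ≡ zeros → p ≡ third x y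
sum≡zeros⇒≡third [] [] [] _ = refl
sum≡zeros⇒≡third (p ∷ ps) (x ∷ xs) (y ∷ ys) eq =
  cong₂ _∷_ (step p x y (∷-injectiveˡ eq)) (sum≡zeros⇒≡third ps xs ys (∷-injectiveʳ eq))
  where
  step : ∀ p x y → (p ⊕ x) ⊕ y ≡ F0 → p ≡ F2 ⊗ (x ⊕ y)
  step = from-yes (all? λ p → all? λ x → all? λ y → (((p ⊕ x) ⊕ y) ≟ᶠ F0) →-dec (p ≟ᶠ (F2 ⊗ (x ⊕ y))))

third-sum≡zeros : ∀ {n} (x y : Vec F₃ n) → (third x y ⊞ x) ⊞ y ≡ zeros
third-sum≡zeros [] [] = refl
third-sum≡zeros (x ∷ xs) (y ∷ ys) = cong₂ _∷_ (step x y) (third-sum≡zeros xs ys)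
  where
  step : ∀ x y → ((F2 ⊗ (x ⊕ y)) ⊕ x) ⊕ y ≡ F0
  step = from-yes (all? λ x → all? λ y → (((F2 ⊗ (x ⊕ y)) ⊕ x) ⊕ y) ≟ᶠ F0)

isLine⇒≡third : ∀ {p x y} → IsLine p x y → p ≡ third x y
isLine⇒≡third {p} {x} {y} (_ , _ , _ , sum≡0) = sum≡zeros⇒≡third p x y sum≡0

third-isLine : ∀ {x y} → x ≢ y → IsLine (third x y) x y
third-isLine {x} {y} x≢y =
  x≢y ∘ third≡ˡ⇒≡ x y , x≢y , x≢y ∘ third≡ʳ⇒≡ x y , third-sum≡zeros x y

≡-displaced : ∀ {n} (a b : Vec F₃ n) → b ≡ a ⊞ F1 ⊙ (b ⊞ F2 ⊙ a)
≡-displaced [] [] = refl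
≡-displaced (a ∷ as) (b ∷ bs) = cong₂ _∷_ (step a b) (≡-displaced as bs)
  where
  step : ∀ a b → b ≡ a ⊕ (F1 ⊗ (b ⊕ (F2 ⊗ a)))
  step = from-yes (all? λ a → all? λ b → b ≟ᶠ (a ⊕ (F1 ⊗ (b ⊕ (F2 ⊗ a)))))

third-displaced : ∀ {n} (a b : Vec F₃ n) → third a b ≡ a ⊞ F2 ⊙ (b ⊞ F2 ⊙ a)
third-displaced [] [] = refl
third-displaced (a ∷ as) (b ∷ bs) = cong₂ _∷_ (step a b) (third-displaced as bs)
  where
  step : ∀ a b → F2 ⊗ (a ⊕ b) ≡ a ⊕ (F2 ⊗ (b ⊕ (F2 ⊗ a)))
  step = from-yes (all? λ a → all? λ b → (F2 ⊗ (a ⊕ b)) ≟ᶠ (a ⊕ (F2 ⊗ (b ⊕ (F2 ⊗ a)))))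

third-displaced-injective : ∀ {n} (a v₁ v₂ v₃ v₄ : Vec F₃ n) →
  third (a ⊞ v₁) (a ⊞ v₂) ≡ third (a ⊞ v₃) (a ⊞ v₄) → ((v₁ ⊞ v₂) ⊞ F2 ⊙ v₃) ⊞ F2 ⊙ v₄ ≡ zeros
third-displaced-injective [] [] [] [] [] _ = refl
third-displaced-injective (a ∷ as) (v₁ ∷ v₁s) (v₂ ∷ v₂s) (v₃ ∷ v₃s) (v₄ ∷ v₄s) eq =
  cong₂ _∷_ (step a v₁ v₂ v₃ v₄ (∷-injectiveˡ eq)) (third-displaced-injective as v₁s v₂s v₃s v₄s (∷-injectiveʳ eq))
  where
  step : ∀ a v₁ v₂ v₃ v₄ → F2 ⊗ ((a ⊕ v₁) ⊕ (a ⊕ v₂)) ≡ F2 ⊗ ((a ⊕ v₃) ⊕ (a ⊕ v₄)) →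
         ((v₁ ⊕ v₂) ⊕ (F2 ⊗ v₃)) ⊕ (F2 ⊗ v₄) ≡ F0
  step = from-yes (all? λ a → all? λ v₁ → all? λ v₂ → all? λ v₃ → all? λ v₄ →
    ((F2 ⊗ ((a ⊕ v₁) ⊕ (a ⊕ v₂))) ≟ᶠ (F2 ⊗ ((a ⊕ v₃) ⊕ (a ⊕ v₄)))) →-dec
    ((((v₁ ⊕ v₂) ⊕ (F2 ⊗ v₃)) ⊕ (F2 ⊗ v₄)) ≟ᶠ F0))

-- Indicator sums over lists

χ : ∀ {A : Set} → Dec A → ℕ
χ (true because _) = 1
χ (false because _) = 0

χ-yes : ∀ {A : Set} → A → (d : Dec A) → χ d ≡ 1
χ-yes x (yes _) = refl
χ-yes x (no ¬x) = ⊥-elim (¬x x)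

χ-no : ∀ {A : Set} → ¬ A → (d : Dec A) → χ d ≡ 0
χ-no ¬x (yes x) = ⊥-elim (¬x x)
χ-no ¬x (no _) = refl

χ-cong : ∀ {A B : Set} → (A → B) → (B → A) → (d : Dec A) (d′ : Dec B) → χ d ≡ χ d′
χ-cong f g (yes x) d′ = sym (χ-yes (f x) d′)
χ-cong f g (no ¬x) d′ = sym (χ-no (¬x ∘ g) d′)

χ-¬ : ∀ {A : Set} (d : Dec A) → χ (¬? d) + χ d ≡ 1
χ-¬ (yes _) = refl
χ-¬ (no _) = refl

∑ : ∀ {X : Set} → List X → (X → ℕ) → ℕ
∑ L f = sum (List.map f L)

length-filter≡∑χ : ∀ {X : Set} {P : X → Set} (P? : Decidable P) L → length (filter P? L) ≡ ∑ L (χ ∘ P?)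
length-filter≡∑χ P? [] = refl
length-filter≡∑χ P? (x ∷ L) with P? x
... | yes _ = cong suc (length-filter≡∑χ P? L)
... | no _ = length-filter≡∑χ P? L

module _ {X : Set} where

  ∑-cong : ∀ L {f g : X → ℕ} → (∀ x → f x ≡ g x) → ∑ L f ≡ ∑ L g
  ∑-cong [] f≗g = refl
  ∑-cong (x ∷ L) f≗g = cong₂ _+_ (f≗g x) (∑-cong L f≗g)

  ∑-cong-All : ∀ {L} {f g : X → ℕ} → All (λ x → f x ≡ g x) L → ∑ L f ≡ ∑ L g
  ∑-cong-All [] = refl
  ∑-cong-All (fx≡gx ∷ rest) = cong₂ _+_ fx≡gx (∑-cong-All rest)

  ∑-+ : ∀ L (f g : X → ℕ) → ∑ L (λ x → f x + g x) ≡ ∑ L f + ∑ L g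
  ∑-+ [] f g = refl
  ∑-+ (x ∷ L) f g = trans (cong (f x + g x +_) (∑-+ L f g)) (interchange +-commutativeSemigroup (f x) (g x) (∑ L f) (∑ L g))

  ∑-*ˡ : ∀ L k (f : X → ℕ) → ∑ L (λ x → k * f x) ≡ k * ∑ L f
  ∑-*ˡ [] k f = sym (*-zeroʳ k)
  ∑-*ˡ (x ∷ L) k f = trans (cong (k * f x +_) (∑-*ˡ L k f)) (sym (*-distribˡ-+ k (f x) (∑ L f)))

  ∑-zero : ∀ L → ∑ L (λ (_ : X) → 0) ≡ 0
  ∑-zero [] = refl
  ∑-zero (_ ∷ L) = ∑-zero L

  ∑χ≤1 : ∀ {P : X → Set} (P? : Decidable P) L → AllPairs (λ x y → ¬ (P x × P y)) L → ∑ L (χ ∘ P?) ≤ 1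
  ∑χ≤1 P? [] _ = z≤n
  ∑χ≤1 P? (x ∷ L) (exclusive ∷ rest) with P? x
  ... | no _ = ∑χ≤1 P? L rest
  ... | yes px = ≤-reflexive (cong suc (trans (∑-cong-All (All.map (λ ¬both → χ-no (λ py → ¬both (px , py)) _) exclusive)) (∑-zero L)))

∑-comm : ∀ {X Y : Set} (L : List X) (M : List Y) (h : X → Y → ℕ) →
         ∑ L (λ x → ∑ M (h x)) ≡ ∑ M (λ y → ∑ L (λ x → h x y))
∑-comm [] M h = sym (∑-zero M)
∑-comm (x ∷ L) M h = trans (cong (∑ M (h x) +_) (∑-comm L M h)) (sym (∑-+ M (h x) _))

allPoints-counts-once : ∀ x → ∑ allPoints (λ p → χ (p ≟ₚ x)) ≡ 1
allPoints-counts-once (x₀ ∷ x₁ ∷ x₂ ∷ x₃ ∷ []) =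
  from-yes (all? λ x₀ → all? λ x₁ → all? λ x₂ → all? λ x₃ →
    ∑ allPoints (λ p → χ (p ≟ₚ (x₀ ∷ x₁ ∷ x₂ ∷ x₃ ∷ []))) ≟ 1) x₀ x₁ x₂ x₃

∑-allPoints-select : ∀ (g : Point → ℕ) x → ∑ allPoints (λ p → g p * χ (p ≟ₚ x)) ≡ g x
∑-allPoints-select g x = begin
  ∑ allPoints (λ p → g p * χ (p ≟ₚ x)) ≡⟨ ∑-cong allPoints select ⟩
  ∑ allPoints (λ p → g x * χ (p ≟ₚ x)) ≡⟨ ∑-*ˡ allPoints (g x) (λ p → χ (p ≟ₚ x)) ⟩
  g x * ∑ allPoints (λ p → χ (p ≟ₚ x)) ≡⟨ cong (g x *_) (allPoints-counts-once x) ⟩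
  g x * 1                              ≡⟨ *-identityʳ (g x) ⟩
  g x                                  ∎
  where
  open ≡-Reasoning
  select : ∀ p → g p * χ (p ≟ₚ x) ≡ g x * χ (p ≟ₚ x)
  select p with p ≟ₚ x
  ... | yes refl = refl
  ... | no _ = trans (*-zeroʳ (g p)) (sym (*-zeroʳ (g x)))

χ-∈-∷ : ∀ {x L} p → x ∉ L → χ (p ∈? x ∷ L) ≡ χ (p ≟ₚ x) + χ (p ∈? L)
χ-∈-∷ {x} {L} p x∉L with p ∈? x ∷ L | p ≟ₚ x | p ∈? L
... | _             | yes refl | yes x∈L = ⊥-elim (x∉L x∈L)
... | yes _         | yes _    | no _    = refl
... | yes _         | no _     | yes _   = refl
... | yes (here eq) | no p≢x   | no _    = ⊥-elim (p≢x eq)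
... | yes (there m) | no _     | no p∉L  = ⊥-elim (p∉L m)
... | no p∉xL       | yes p≡x  | _       = ⊥-elim (p∉xL (here p≡x))
... | no p∉xL       | no _     | yes m   = ⊥-elim (p∉xL (there m))
... | no _          | no _     | no _    = refl

∑-allPoints-∈ : ∀ L → Unique L → ∑ allPoints (λ p → χ (p ∈? L)) ≡ length L
∑-allPoints-∈ [] _ = ∑-zero allPoints
∑-allPoints-∈ (x ∷ L) (x≢L ∷ unique) = begin
  ∑ allPoints (λ p → χ (p ∈? x ∷ L))                         ≡⟨ ∑-cong allPoints (λ p → χ-∈-∷ p (All¬⇒¬Any x≢L)) ⟩
  ∑ allPoints (λ p → χ (p ≟ₚ x) + χ (p ∈? L))                ≡⟨ ∑-+ allPoints (λ p → χ (p ≟ₚ x)) (λ p → χ (p ∈? L)) ⟩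
  ∑ allPoints (λ p → χ (p ≟ₚ x)) + ∑ allPoints (λ p → χ (p ∈? L)) ≡⟨ cong₂ _+_ (allPoints-counts-once x) (∑-allPoints-∈ L unique) ⟩
  suc (length L)                                             ∎
  where open ≡-Reasoning

-- The geometry of a demicap

module DemicapGeometry (D : Demicap) where
  open Demicap D

  Tag : Set
  Tag = Fin 5 × Bool

  pt : Tag → Point
  pt (i , true) = b i
  pt (i , false) = c i

  -- Chosen so that map pt tags computes to points, and pairsOf points to the image of tagPairs.
  tags : List Tag
  tags = List.concatMap (λ i → (i , true) ∷ (i , false) ∷ []) (List.allFin 5)

  anchor≡third : ∀ i → anchor ≡ third (b i) (c i)
  anchor≡third i = isLine⇒≡third (aLine i)

  c≡third : ∀ i → c i ≡ third anchor (b i)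
  c≡third i = begin
    c i                             ≡⟨ sym (third-involutive (b i) (c i)) ⟩
    third (b i) (third (b i) (c i)) ≡⟨ cong (third (b i)) (sym (anchor≡third i)) ⟩
    third (b i) anchor              ≡⟨ third-comm (b i) anchor ⟩
    third anchor (b i)              ∎
    where open ≡-Reasoning

  third-anchor-pt : ∀ i s → third anchor (pt (i , s)) ≡ pt (i , not s)
  third-anchor-pt i true = sym (c≡third i)
  third-anchor-pt i false = trans (cong (third anchor) (c≡third i)) (third-involutive anchor (b i))

  u : Fin 5 → Point
  u i = b i ⊞ F2 ⊙ anchor

  sign : Bool → F₃
  sign true = F1
  sign false = F2

  displacement : Tag → Point
  displacement (i , s) = sign s ⊙ u i

  pt-displaced : ∀ t → pt t ≡ anchor ⊞ displacement t
  pt-displaced (i , true) = ≡-displaced anchor (b i)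
  pt-displaced (i , false) = trans (c≡third i) (third-displaced anchor (b i))

  anchor≢pt : ∀ t → anchor ≢ pt t
  anchor≢pt (i , true) = proj₁ (aLine i)
  anchor≢pt (i , false) = proj₁ (proj₂ (proj₂ (aLine i)))

  b≢c : ∀ i → b i ≢ c i
  b≢c i = proj₁ (proj₂ (aLine i))

  partner-≡ : ∀ i s j s′ → pt (i , s) ≡ pt (j , s′) → pt (i , not s) ≡ pt (j , not s′)
  partner-≡ i s j s′ eq = begin
    pt (i , not s)             ≡⟨ sym (third-anchor-pt i s) ⟩
    third anchor (pt (i , s))  ≡⟨ cong (third anchor) eq ⟩
    third anchor (pt (j , s′)) ≡⟨ third-anchor-pt j s′ ⟩
    pt (j , not s′)            ∎
    where open ≡-Reasoning

  same-aLine : ∀ i s j s′ → pt (i , s) ≡ pt (j , s′) → (b i ≡ b j × c i ≡ c j) ⊎ (b i ≡ c j × c i ≡ b j)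
  same-aLine i true  j true  eq = inj₁ (eq , partner-≡ i true j true eq)
  same-aLine i false j false eq = inj₁ (partner-≡ i false j false eq , eq)
  same-aLine i true  j false eq = inj₂ (eq , partner-≡ i true j false eq)
  same-aLine i false j true  eq = inj₂ (partner-≡ i false j true eq , eq)

  pt-injective : ∀ {t t′} → pt t ≡ pt t′ → t ≡ t′
  pt-injective {i , s} {j , s′} eq with i ≟ᶠ j
  ... | no i≢j = ⊥-elim (distinctLines i j i≢j (same-aLine i s j s′ eq))
  pt-injective {i , true}  {.i , true}  eq | yes refl = refl
  pt-injective {i , false} {.i , false} eq | yes refl = refl
  pt-injective {i , true}  {.i , false} eq | yes refl = ⊥-elim (b≢c i eq)
  pt-injective {i , false} {.i , true}  eq | yes refl = ⊥-elim (b≢c i (sym eq))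

  _≟ᵗ_ : (t t′ : Tag) → Dec (t ≡ t′)
  _≟ᵗ_ = ≡-dec-× _≟ᶠ_ _≟ᵇ_

  open DecMembership _≟ᵗ_ using () renaming (_∈_ to _∈ᵗ_; _∈?_ to _∈ᵗ?_)

  pt∈points : ∀ t → pt t ∈ points
  pt∈points t = ∈-map⁺ pt (tags-complete t)
    where
    tags-complete : ∀ t → t ∈ᵗ tags
    tags-complete (i , true) = from-yes (all? λ i → (i , true) ∈ᵗ? tags) i
    tags-complete (i , false) = from-yes (all? λ i → (i , false) ∈ᵗ? tags) i

  points-unique : Unique points
  points-unique = Unique.map⁺ pt-injective (from-yes (allPairs? (λ t t′ → ¬? (t ≟ᵗ t′)) tags))

  anchor∉points : anchor ∉ points
  anchor∉points anchor∈points with ∈-map⁻ pt {xs = tags} anchor∈points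
  ... | t , _ , anchor≡pt = anchor≢pt t anchor≡pt

  tagPairs : List (Tag × Tag)
  tagPairs = pairsOf tags

  Distinct : Tag × Tag → Set
  Distinct τ = proj₁ τ ≢ proj₂ τ

  SameLine : Tag × Tag → Set
  SameLine τ = proj₁ (proj₁ τ) ≡ proj₁ (proj₂ τ)

  sameLine? : ∀ τ → Dec (SameLine τ)
  sameLine? τ = proj₁ (proj₁ τ) ≟ᶠ proj₁ (proj₂ τ)

  tagPairs-distinct : All Distinct tagPairs
  tagPairs-distinct = from-yes (All.all? (λ τ → ¬? (proj₁ τ ≟ᵗ proj₂ τ)) tagPairs)

  thirdOf : Tag × Tag → Point
  thirdOf (t , t′) = third (pt t) (pt t′)

  thirdOf∉points : ∀ τ → Distinct τ → thirdOf τ ∉ points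
  thirdOf∉points (t , t′) t≢t′ thirdOf∈points =
    isCap _ _ _ thirdOf∈points (pt∈points t) (pt∈points t′) (third-isLine (t≢t′ ∘ pt-injective))

  sameLine⇒thirdOf≡anchor : ∀ τ → Distinct τ → SameLine τ → thirdOf τ ≡ anchor
  sameLine⇒thirdOf≡anchor ((i , true)  , (.i , true))  t≢t′ refl = ⊥-elim (t≢t′ refl)
  sameLine⇒thirdOf≡anchor ((i , false) , (.i , false)) t≢t′ refl = ⊥-elim (t≢t′ refl)
  sameLine⇒thirdOf≡anchor ((i , true)  , (.i , false)) _ refl = sym (anchor≡third i)
  sameLine⇒thirdOf≡anchor ((i , false) , (.i , true))  _ refl = trans (third-comm (c i) (b i)) (sym (anchor≡third i))

  thirdOf≡anchor⇒sameLine : ∀ τ → thirdOf τ ≡ anchor → SameLine τ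
  thirdOf≡anchor⇒sameLine ((i , s) , (j , s′)) eq = sym (cong proj₁ (pt-injective {j , s′} {i , not s} (begin
    pt (j , s′)                               ≡⟨ sym (third-involutive (pt (i , s)) (pt (j , s′))) ⟩
    third (pt (i , s)) (thirdOf ((i , s) , (j , s′))) ≡⟨ cong (third (pt (i , s))) eq ⟩
    third (pt (i , s)) anchor                 ≡⟨ third-comm (pt (i , s)) anchor ⟩
    third anchor (pt (i , s))                 ≡⟨ third-anchor-pt i s ⟩
    pt (i , not s)                            ∎)))
    where open ≡-Reasoning

  completions≡∑ : ∀ p → completions p ≡ ∑ tagPairs (λ τ → χ (p ≟ₚ thirdOf τ))
  completions≡∑ p = trans (length-filter≡∑χ (λ xy → isLine? p (proj₁ xy) (proj₂ xy)) (pairsOf points))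
                          (∑-cong-All (All.map (λ {τ} → χ-isLine τ) tagPairs-distinct))
    where
    χ-isLine : ∀ τ → Distinct τ → χ (isLine? p (pt (proj₁ τ)) (pt (proj₂ τ))) ≡ χ (p ≟ₚ thirdOf τ)
    χ-isLine (t , t′) t≢t′ = χ-cong isLine⇒≡third
      (λ { refl → third-isLine (t≢t′ ∘ pt-injective) }) _ _

  coeff : Tag → Fin 5 → F₃
  coeff (i , s) = unit i (sign s)

  lin-coeff : ∀ t → lin (coeff t) u ≡ displacement t
  lin-coeff (i , s) = lin-unit i (sign s) u

  relationCoeffs : Tag × Tag → Tag × Tag → Fin 5 → F₃
  relationCoeffs (t₁ , t₂) (t₃ , t₄) k = ((coeff t₁ k ⊕ coeff t₂ k) ⊕ (F2 ⊗ coeff t₃ k)) ⊕ (F2 ⊗ coeff t₄ k)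

  thirdOf-collision : ∀ τ τ′ → thirdOf τ ≡ thirdOf τ′ → lin (relationCoeffs τ τ′) u ≡ zeros
  thirdOf-collision (t₁ , t₂) (t₃ , t₄) eq = begin
    lin (relationCoeffs (t₁ , t₂) (t₃ , t₄)) u
      ≡⟨ lin-⊞ (λ k → (coeff t₁ k ⊕ coeff t₂ k) ⊕ (F2 ⊗ coeff t₃ k)) (λ k → F2 ⊗ coeff t₄ k) u ⟩
    lin (λ k → (coeff t₁ k ⊕ coeff t₂ k) ⊕ (F2 ⊗ coeff t₃ k)) u ⊞ lin (λ k → F2 ⊗ coeff t₄ k) u
      ≡⟨ cong₂ _⊞_ (lin-⊞ (λ k → coeff t₁ k ⊕ coeff t₂ k) (λ k → F2 ⊗ coeff t₃ k) u) (lin-⊙ F2 (coeff t₄) u) ⟩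
    (lin (λ k → coeff t₁ k ⊕ coeff t₂ k) u ⊞ lin (λ k → F2 ⊗ coeff t₃ k) u) ⊞ F2 ⊙ lin (coeff t₄) u
      ≡⟨ cong (λ x → x ⊞ F2 ⊙ lin (coeff t₄) u) (cong₂ _⊞_ (lin-⊞ (coeff t₁) (coeff t₂) u) (lin-⊙ F2 (coeff t₃) u)) ⟩
    ((lin (coeff t₁) u ⊞ lin (coeff t₂) u) ⊞ F2 ⊙ lin (coeff t₃) u) ⊞ F2 ⊙ lin (coeff t₄) u
      ≡⟨ cong₂ (λ x y → x ⊞ F2 ⊙ y) (cong₂ (λ x y → x ⊞ F2 ⊙ y) (cong₂ _⊞_ (lin-coeff t₁) (lin-coeff t₂)) (lin-coeff t₃)) (lin-coeff t₄) ⟩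
    ((displacement t₁ ⊞ displacement t₂) ⊞ F2 ⊙ displacement t₃) ⊞ F2 ⊙ displacement t₄
      ≡⟨ third-displaced-injective anchor _ _ _ _ displaced-eq ⟩
    zeros ∎
    where
    open ≡-Reasoning
    displaced-eq : third (anchor ⊞ displacement t₁) (anchor ⊞ displacement t₂)
                 ≡ third (anchor ⊞ displacement t₃) (anchor ⊞ displacement t₄)
    displaced-eq = begin
      third (anchor ⊞ displacement t₁) (anchor ⊞ displacement t₂) ≡⟨ sym (cong₂ third (pt-displaced t₁) (pt-displaced t₂)) ⟩
      thirdOf (t₁ , t₂)                                             ≡⟨ eq ⟩
      thirdOf (t₃ , t₄)                                             ≡⟨ cong₂ third (pt-displaced t₃) (pt-displaced t₄) ⟩
      third (anchor ⊞ displacement t₃) (anchor ⊞ displacement t₄) ∎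

  ShortRelation : (Fin 5 → F₃) → Set
  ShortRelation w = (∃[ m ] w m ≡ F0) × (∃[ k ] w k ≢ F0)

  no-short-relation : ∀ w → ShortRelation w → lin w u ≢ zeros
  no-short-relation w ((m , wm≡0) , (k , wk≢0)) relation =
    noFourInHyperplane (punchIn m) (punchIn-injective m _ _)
      (H , λ k → refl , on-H true k , on-H false k)
    where
    m≢k : m ≢ k
    m≢k refl = wk≢0 wm≡0
    annihilator = annihilator-of-dependent ≤-refl (u ∘ punchIn m) (w ∘ punchIn m) (punchOut m≢k)
      (wk≢0 ∘ subst (λ i → w i ≡ F0) (punchIn-punchOut m≢k))
      (trans (sym (lin-punchIn w u m wm≡0)) relation)
    f = proj₁ annihilator
    H : Hyperplane
    H = record { normal = f ; nonzero = proj₁ (proj₂ annihilator) ; constant = f · anchor }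
    on-H : ∀ s k → pt (punchIn m k , s) ∈H H
    on-H s k = trans (cong (f ·_) (pt-displaced (punchIn m k , s)))
                     (·-⊞-⊙-annihilated f anchor (u (punchIn m k)) (sign s) (proj₂ (proj₂ annihilator) k))

  -- Checked by computation: unless one of two distinct pairs lies on a line through the anchor,
  -- the relation between their coordinates is nonzero and misses one of the u i.
  Separated : Tag × Tag → Tag × Tag → Set
  Separated τ τ′ = Distinct τ × Distinct τ′ × (SameLine τ ⊎ SameLine τ′ ⊎ ShortRelation (relationCoeffs τ τ′))

  tagPairs-separated : AllPairs Separated tagPairs
  tagPairs-separated = from-yes (allPairs? separated? tagPairs)
    where
    separated? : ∀ τ τ′ → Dec (Separated τ τ′)
    separated? τ τ′ =
      ¬? (proj₁ τ ≟ᵗ proj₂ τ) ×-dec ¬? (proj₁ τ′ ≟ᵗ proj₂ τ′) ×-dec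
      (sameLine? τ ⊎-dec sameLine? τ′ ⊎-dec
       (any? (λ m → relationCoeffs τ τ′ m ≟ᶠ F0) ×-dec any? (λ k → ¬? (relationCoeffs τ τ′ k ≟ᶠ F0))))

  completions≤1 : ∀ p → p ≢ anchor → completions p ≤ 1
  completions≤1 p p≢anchor = subst (_≤ 1) (sym (completions≡∑ p))
    (∑χ≤1 (λ τ → p ≟ₚ thirdOf τ) tagPairs (AllPairs.map (λ {τ} {τ′} → not-both τ τ′) tagPairs-separated))
    where
    not-both : ∀ τ τ′ → Separated τ τ′ → ¬ (p ≡ thirdOf τ × p ≡ thirdOf τ′)
    not-both τ τ′ (d , _ , inj₁ same) (p≡ , _) = p≢anchor (trans p≡ (sameLine⇒thirdOf≡anchor τ d same))
    not-both τ τ′ (_ , d′ , inj₂ (inj₁ same)) (_ , p≡′) = p≢anchor (trans p≡′ (sameLine⇒thirdOf≡anchor τ′ d′ same))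
    not-both τ τ′ (_ , _ , inj₂ (inj₂ short)) (p≡ , p≡′) =
      no-short-relation _ short (thirdOf-collision τ τ′ (trans (sym p≡) p≡′))

  offD? : (p : Point) → Dec (p ∉ points)
  offD? p = ¬? (p ∈? points)

  offD-offAnchor? : (p : Point) → Dec (p ∉ points × p ≢ anchor)
  offD-offAnchor? p = offD? p ×-dec ¬? (p ≟ₚ anchor)

  oneCompletion? : (p : Point) → Dec (p ∉ points × p ≢ anchor × completions p ≡ 1)
  oneCompletion? p = offD? p ×-dec (¬? (p ≟ₚ anchor) ×-dec (completions p ≟ 1))

  noCompletion? : (p : Point) → Dec (p ∉ points × completions p ≡ 0)
  noCompletion? p = offD? p ×-dec (completions p ≟ 0)

  χ-offD-offAnchor-thirdOf : ∀ τ → Distinct τ → χ (offD-offAnchor? (thirdOf τ)) ≡ χ (¬? (sameLine? τ))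
  χ-offD-offAnchor-thirdOf τ d = χ-cong
    (λ { (_ , ≢anchor) same → ≢anchor (sameLine⇒thirdOf≡anchor τ d same) })
    (λ crossing → thirdOf∉points τ d , crossing ∘ thirdOf≡anchor⇒sameLine τ) _ _

  completions-anchor : completions anchor ≡ 5
  completions-anchor = trans (completions≡∑ anchor) (∑-cong-All {g = χ ∘ sameLine?} (All.map (λ {τ} d →
    χ-cong (thirdOf≡anchor⇒sameLine τ ∘ sym) (sym ∘ sameLine⇒thirdOf≡anchor τ d) (anchor ≟ₚ thirdOf τ) (sameLine? τ))
    tagPairs-distinct))

  ∑-completions-offD-offAnchor≡40 : ∑ allPoints (λ p → χ (offD-offAnchor? p) * completions p) ≡ 40
  ∑-completions-offD-offAnchor≡40 = begin
    ∑ allPoints (λ p → χ (offD-offAnchor? p) * completions p)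
      ≡⟨ ∑-cong allPoints (λ p → trans (cong (χ (offD-offAnchor? p) *_) (completions≡∑ p)) (sym (∑-*ˡ tagPairs (χ (offD-offAnchor? p)) (λ τ → χ (p ≟ₚ thirdOf τ))))) ⟩
    ∑ allPoints (λ p → ∑ tagPairs (λ τ → χ (offD-offAnchor? p) * χ (p ≟ₚ thirdOf τ)))
      ≡⟨ ∑-comm allPoints tagPairs (λ p τ → χ (offD-offAnchor? p) * χ (p ≟ₚ thirdOf τ)) ⟩
    ∑ tagPairs (λ τ → ∑ allPoints (λ p → χ (offD-offAnchor? p) * χ (p ≟ₚ thirdOf τ)))
      ≡⟨ ∑-cong tagPairs (λ τ → ∑-allPoints-select (χ ∘ offD-offAnchor?) (thirdOf τ)) ⟩
    ∑ tagPairs (λ τ → χ (offD-offAnchor? (thirdOf τ)))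
      ≡⟨ ∑-cong-All (All.map (λ {τ} → χ-offD-offAnchor-thirdOf τ) tagPairs-distinct) ⟩
    ∑ tagPairs (λ τ → χ (¬? (sameLine? τ)))
      ≡⟨⟩
    40 ∎
    where open ≡-Reasoning

  -- The decisions are spelt out so that the with-clauses below can abstract over them.
  χ-oneCompletion : ∀ p → χ (¬? (p ∈? points) ×-dec (¬? (p ≟ₚ anchor) ×-dec (completions p ≟ 1)))
                        ≡ χ (¬? (p ∈? points) ×-dec ¬? (p ≟ₚ anchor)) * completions p
  χ-oneCompletion p with p ∈? points | p ≟ₚ anchor
  ... | yes _ | _ = refl
  ... | no _  | yes _ = refl
  ... | no _  | no p≢anchor with completions p | completions≤1 p p≢anchor
  ...   | 0 | _ = refl
  ...   | 1 | _ = refl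
  ...   | suc (suc _) | s≤s ()

  χ-partition : ∀ p → χ (¬? (p ∈? points) ×-dec (completions p ≟ 0))
                    + χ (¬? (p ∈? points) ×-dec (¬? (p ≟ₚ anchor) ×-dec (completions p ≟ 1)))
                    + χ (p ≟ₚ anchor)
                    ≡ χ (¬? (p ∈? points))
  χ-partition p with p ∈? points | p ≟ₚ anchor
  ... | yes _ | no _ = refl
  ... | yes anchor∈points | yes refl = ⊥-elim (anchor∉points anchor∈points)
  ... | no _ | yes refl rewrite completions-anchor = refl
  ... | no _ | no p≢anchor with completions p | completions≤1 p p≢anchor
  ...   | 0 | _ = refl
  ...   | 1 | _ = refl
  ...   | suc (suc _) | s≤s ()

  ∑χ-offD≡71 : ∑ allPoints (χ ∘ offD?) ≡ 71
  ∑χ-offD≡71 = +-cancelʳ-≡ 10 _ _ (begin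
    ∑ allPoints (χ ∘ offD?) + 10
      ≡⟨ cong (∑ allPoints (χ ∘ offD?) +_) (sym (∑-allPoints-∈ points points-unique)) ⟩
    ∑ allPoints (χ ∘ offD?) + ∑ allPoints (λ p → χ (p ∈? points))
      ≡⟨ sym (∑-+ allPoints (χ ∘ offD?) (λ p → χ (p ∈? points))) ⟩
    ∑ allPoints (λ p → χ (offD? p) + χ (p ∈? points))
      ≡⟨ ∑-cong allPoints (λ p → χ-¬ (p ∈? points)) ⟩
    81 ∎)
    where open ≡-Reasoning

  ∑χ-oneCompletion≡40 : ∑ allPoints (χ ∘ oneCompletion?) ≡ 40
  ∑χ-oneCompletion≡40 = trans (∑-cong allPoints χ-oneCompletion) ∑-completions-offD-offAnchor≡40

  ∑χ-noCompletion≡30 : ∑ allPoints (χ ∘ noCompletion?) ≡ 30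
  ∑χ-noCompletion≡30 = +-cancelʳ-≡ 41 _ _ (begin
    ∑ allPoints (χ ∘ noCompletion?) + (40 + 1)
      ≡⟨ cong (∑ allPoints (χ ∘ noCompletion?) +_)
              (sym (cong₂ _+_ ∑χ-oneCompletion≡40 (allPoints-counts-once anchor))) ⟩
    ∑ allPoints (χ ∘ noCompletion?) + (∑ allPoints (χ ∘ oneCompletion?) + ∑ allPoints (λ p → χ (p ≟ₚ anchor)))
      ≡⟨ sym (+-assoc (∑ allPoints (χ ∘ noCompletion?)) _ _) ⟩
    ∑ allPoints (χ ∘ noCompletion?) + ∑ allPoints (χ ∘ oneCompletion?) + ∑ allPoints (λ p → χ (p ≟ₚ anchor))
      ≡⟨ cong (_+ ∑ allPoints (λ p → χ (p ≟ₚ anchor))) (sym (∑-+ allPoints (χ ∘ noCompletion?) (χ ∘ oneCompletion?))) ⟩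
    ∑ allPoints (λ p → χ (noCompletion? p) + χ (oneCompletion? p)) + ∑ allPoints (λ p → χ (p ≟ₚ anchor))
      ≡⟨ sym (∑-+ allPoints (λ p → χ (noCompletion? p) + χ (oneCompletion? p)) (λ p → χ (p ≟ₚ anchor))) ⟩
    ∑ allPoints (λ p → χ (noCompletion? p) + χ (oneCompletion? p) + χ (p ≟ₚ anchor))
      ≡⟨ ∑-cong allPoints χ-partition ⟩
    ∑ allPoints (χ ∘ offD?)
      ≡⟨ ∑χ-offD≡71 ⟩
    71 ∎)
    where open ≡-Reasoning

corollary3p5 : (D : Demicap) →
  let open Demicap D in
  length (filter (λ p → ¬? (p ∈? points)) allPoints) ≡ 71
  × anchor ∉ points
  × (∀ p → p ∉ points → p ≢ anchor → completions p ≡ 0 ⊎ completions p ≡ 1)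
  × length (filter (λ p → ¬? (p ∈? points) ×-dec (¬? (p ≟ₚ anchor) ×-dec (completions p ≟ 1))) allPoints) ≡ 40
  × length (filter (λ p → ¬? (p ∈? points) ×-dec (completions p ≟ 0)) allPoints) ≡ 30
corollary3p5 D =
  trans (length-filter≡∑χ offD? allPoints) ∑χ-offD≡71 ,
  anchor∉points ,
  (λ p _ p≢anchor → ≤1⇒≡0⊎≡1 (completions≤1 p p≢anchor)) ,
  trans (length-filter≡∑χ oneCompletion? allPoints) ∑χ-oneCompletion≡40 ,
  trans (length-filter≡∑χ noCompletion? allPoints) ∑χ-noCompletion≡30
  where
  open DemicapGeometry D
  ≤1⇒≡0⊎≡1 : ∀ {n} → n ≤ 1 → n ≡ 0 ⊎ n ≡ 1
  ≤1⇒≡0⊎≡1 z≤n = inj₁ refl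
  ≤1⇒≡0⊎≡1 (s≤s z≤n) = inj₂ refl
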